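{- Let $n,k$ be nonnegative integers, let $s\ge 1$, and let $\ell$ be an integer with $0\le \ell<s+1$ and $\gcd(\ell,s+1)=1$. Let $r\in\{0,1,\dots,s\}$ be the remainder of $k\ell^{ -1}$ upon division by $s+1$ (where $\ell^{ -1}$ is the inverse of $\ell$ modulo $s+1$). Then \[ M^{(s,\ell)}_k(1,\dots ,n)=\sum _{i = 0}^{\min \{\lfloor \frac{n-r}{s+1}\rfloor ,\lfloor \frac{k}{s+1}\rfloor - \lfloor \frac{r \ell}{s+1}\rfloor \}}h_{\lfloor \frac{k}{s+1}\rfloor -\lfloor \frac{r \ell}{s+1}\rfloor -i \ell}(1^{s+1},\dots ,n^{s+1})\left [{n+1\atop n+1-r-i (s+1)}\right ]_\ell . \]
   Context: For $0\le\ell<s+1$, the $\ell$-modular symmetric function is $M_k^{(s,\ell)}(x_1,\dots ,x_n)=\sum x_1^{j_1}\cdots x_n^{j_n}$, the sum over all $n$-tuples of nonnegative integers $(j_1,\dots,j_n)$ with $j_1+\cdots+j_n=k$ and each $j_i\equiv 0$ or $j_i\equiv \ell \pmod{s+1}$. $h_m$ is the complete homogeneous symmetric polynomial of degree $m$, with $h_0=1$ and $h_m=0$ for $m<0$. The Stirling numbers of the first kind of higher level $\ell$, $\left[{N\atop j}\right]_\ell$, are defined by $x(x+1^\ell)(x+2^\ell)\cdots(x+(N-1)^\ell)=\sum_{j=0}^N \left[{N\atop j}\right]_\ell x^j$ for $N\ge0$ (the empty product being $1$). -}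

module Defs where

open import Data.Nat using (ℕ; zero; suc; _+_; _*_; _∸_; _^_; _%_; _≡ᵇ_)
open import Data.Bool using (Bool; _∨_)
open import Data.List using (List; []; _∷_; map; concatMap; upTo; filterᵇ; foldr)
open import Data.Vec using (Vec; []; _∷_; tabulate)
open import Data.Fin using (Fin; toℕ)
open import Data.Integer using (ℤ; +_; -[1+_])

sumL : List ℕ → ℕ
sumL = foldr _+_ 0

weakComps : (n k : ℕ) → List (Vec ℕ n)
weakComps zero zero = [] ∷ []
weakComps zero (suc k) = []
weakComps (suc n) k = concatMap (λ j → map (j ∷_) (weakComps n (k ∸ j))) (upTo (suc k))

monomial : ∀ {n} → Vec ℕ n → Vec ℕ n → ℕ
monomial [] [] = 1
monomial (x ∷ xs) (j ∷ js) = x ^ j * monomial xs js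

allAdmissible : ∀ {n} → (s ℓ : ℕ) → Vec ℕ n → Bool
allAdmissible s ℓ [] = Data.Bool.true
allAdmissible s ℓ (j ∷ js) =
  (((j % suc s) ≡ᵇ 0) ∨ ((j % suc s) ≡ᵇ (ℓ % suc s))) Data.Bool.∧ allAdmissible s ℓ js

modSym : (s ℓ k : ℕ) → ∀ {n} → Vec ℕ n → ℕ
modSym s ℓ k {n} xs = sumL (map (monomial xs) (filterᵇ (allAdmissible s ℓ) (weakComps n k)))

hNat : ℕ → ∀ {n} → Vec ℕ n → ℕ
hNat m {n} ys = sumL (map (monomial ys) (weakComps n m))

-- h_m with integer index; h_m = 0 for m < 0
hInt : ℤ → ∀ {n} → Vec ℕ n → ℕ
hInt (+ m) ys = hNat m ys
hInt -[1+ _ ] ys = 0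

-- polynomials in x with ℕ coefficients, as coefficient lists (constant term first)
Poly : Set
Poly = List ℕ

_⊕_ : Poly → Poly → Poly
[] ⊕ q = q
(a ∷ p) ⊕ [] = a ∷ p
(a ∷ p) ⊕ (b ∷ q) = (a + b) ∷ (p ⊕ q)

scale : ℕ → Poly → Poly
scale c = map (c *_)

_⊗_ : Poly → Poly → Poly
[] ⊗ q = []
(a ∷ p) ⊗ q = scale a q ⊕ (0 ∷ (p ⊗ q))

coeff : Poly → ℕ → ℕ
coeff [] j = 0
coeff (a ∷ p) zero = a
coeff (a ∷ p) (suc j) = coeff p j

-- coefficient of x^j for integer j (0 for j < 0)
coeffℤ : Poly → ℤ → ℕ
coeffℤ p (+ j) = coeff p j
coeffℤ p -[1+ _ ] = 0

-- x (x + 1^ℓ) (x + 2^ℓ) ⋯ (x + (N-1)^ℓ)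
risingPoly : (ℓ N : ℕ) → Poly
risingPoly ℓ N = foldr (λ m acc → (m ^ ℓ ∷ 1 ∷ []) ⊗ acc) (1 ∷ []) (upTo N)

stirlingℓ : (ℓ N : ℕ) → ℤ → ℕ
stirlingℓ ℓ N j = coeffℤ (risingPoly ℓ N) j

-- Σ_{i=0}^{U} f i for integer U (empty sum if U < 0)
sumTo : ℤ → (ℕ → ℕ) → ℕ
sumTo (+ u) f = sumL (map f (upTo (suc u)))
sumTo -[1+ _ ] f = 0

powVec : (n e : ℕ) → Vec ℕ n
powVec n e = tabulate (λ (i : Fin n) → suc (toℕ i) ^ e)

-- As power series in t,
--   Σₖ M_k^(s,ℓ)(x) tᵏ = ∏ᵢ (1 + xᵢ^ℓ t^ℓ) / (1 − xᵢ^d t^d)  (d = s + 1)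
--                     = E(t^ℓ) · H(t^d),   E(u) = Σ e_m(x^ℓ) uᵐ,  H(v) = Σ h_a(x^d) vᵃ,
-- so M_k = Σ_{m ℓ + a d = k} e_m(x^ℓ) h_a(x^d).  A term needs m ℓ ≡ k (mod d), i.e. m ≡ r;
-- with m = r + i d the exponent is a = ⌊k/d⌋ − ⌊r ℓ/d⌋ − i ℓ, and by Vieta
-- e_m(1^ℓ, …, n^ℓ) is the coefficient of x^(n+1−m) in x (x + 1^ℓ) ⋯ (x + n^ℓ),
-- the Stirling number [n+1, n+1−m]_ℓ.  The range of i is where both factors can be nonzero.
module Submission where

open import Defs
open import Data.Nat using (ℕ; suc; _+_; _*_; _<_; _≤_; _%_; _/_)
open import Data.Nat.GCD using (gcd)
open import Data.Integer using (ℤ; +_; _-_; _⊓_; _/ℕ_)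
open import Relation.Binary.PropositionalEquality using (_≡_)

open import Algebra.Properties.CommutativeSemigroup using (interchange)
open import Data.Bool using (Bool; true; false; if_then_else_; _∧_; _∨_)
open import Data.Fin using (toℕ)
open import Data.Integer using (-[1+_]; -_)
import Data.Integer as ℤ
import Data.Integer.Properties as ℤP
open import Data.List as List using (List; []; _∷_; concatMap; applyUpTo; upTo; filterᵇ)
open import Data.List.Properties using (map-++; map-cong)
open import Data.Nat using (zero; _∸_; _^_; z≤n; s≤s; NonZero)
open import Data.Nat.DivMod
open import Data.Nat.ListAction.Properties using (sum-++)
open import Data.Nat.Properties
open import Data.Nat.Solver using (module +-*-Solver)
open import Data.Product using (Σ-syntax; _×_; _,_)
open import Data.Vec as Vec using (Vec; []; _∷_; tabulate)
open import Data.Vec.Properties using (tabulate-∘; tabulate-cong)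
open import Function.Base using (_∘_; const; _⟨_⟩_)
open import Relation.Binary.PropositionalEquality
  using (refl; sym; trans; cong; cong₂; subst; subst₂; _≗_; _≢_; ≢-sym; module ≡-Reasoning)
open import Relation.Nullary using (does; yes; no; contradiction)
open import Relation.Nullary.Decidable using (dec-true; dec-false)

open +-*-Solver using (solve; _:+_; _:*_; _:=_; con)
open ≡-Reasoning

-- Formal power series over ℕ

Series : Set
Series = ℕ → ℕ

∑< : ℕ → Series → ℕ
∑< zero    f = 0
∑< (suc N) f = f 0 + ∑< N (f ∘ suc)

∑<-cong : ∀ N {f g : Series} → f ≗ g → ∑< N f ≡ ∑< N g
∑<-cong zero    f≗g = refl
∑<-cong (suc N) f≗g = cong₂ _+_ (f≗g 0) (∑<-cong N (f≗g ∘ suc))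

∑<-zero : ∀ N {f : Series} → f ≗ const 0 → ∑< N f ≡ 0
∑<-zero zero    f≗0 = refl
∑<-zero (suc N) f≗0 = cong₂ _+_ (f≗0 0) (∑<-zero N (f≗0 ∘ suc))

∑<-+ : ∀ N (f g : Series) → ∑< N (λ j → f j + g j) ≡ ∑< N f + ∑< N g
∑<-+ zero    f g = refl
∑<-+ (suc N) f g = begin
  (f 0 + g 0) + ∑< N (λ j → f (suc j) + g (suc j))
    ≡⟨ cong (_+_ (f 0 + g 0)) (∑<-+ N (f ∘ suc) (g ∘ suc)) ⟩
  (f 0 + g 0) + (∑< N (f ∘ suc) + ∑< N (g ∘ suc))
    ≡⟨ interchange +-commutativeSemigroup (f 0) (g 0) _ _ ⟩
  (f 0 + ∑< N (f ∘ suc)) + (g 0 + ∑< N (g ∘ suc)) ∎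

∑<-*ˡ : ∀ N c (f : Series) → ∑< N (λ j → c * f j) ≡ c * ∑< N f
∑<-*ˡ zero    c f = sym (*-zeroʳ c)
∑<-*ˡ (suc N) c f =
  trans (cong (_+_ (c * f 0)) (∑<-*ˡ N c (f ∘ suc))) (sym (*-distribˡ-+ c (f 0) _))

infixl 7 _⋆_

_⋆_ : Series → Series → Series
(f ⋆ g) k = ∑< (suc k) (λ j → f j * g (k ∸ j))

𝟙 : Series
𝟙 zero    = 1
𝟙 (suc _) = 0

linear : ℕ → Series
linear c zero          = 1
linear c (suc zero)    = c
linear c (suc (suc _)) = 0

⋆-cong : ∀ {f f′ g g′ : Series} → f ≗ f′ → g ≗ g′ → f ⋆ g ≗ f′ ⋆ g′
⋆-cong f≗f′ g≗g′ k = ∑<-cong (suc k) (λ j → cong₂ _*_ (f≗f′ j) (g≗g′ (k ∸ j)))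

⋆-sucʳ : ∀ (f g : Series) k → (f ⋆ g) (suc k) ≡ (f ⋆ (g ∘ suc)) k + f (suc k) * g 0
⋆-sucʳ f g zero    = solve 2 (λ a b → a :+ (b :+ con 0) := (a :+ con 0) :+ b) refl (f 0 * g 1) (f 1 * g 0)
⋆-sucʳ f g (suc k) =
  trans (cong (_+_ (f 0 * g (2 + k))) (⋆-sucʳ (f ∘ suc) g k)) (sym (+-assoc (f 0 * g (2 + k)) _ _))

⋆-comm : ∀ (f g : Series) → f ⋆ g ≗ g ⋆ f
⋆-comm f g zero    = cong (_+ 0) (*-comm (f 0) (g 0))
⋆-comm f g (suc k) = begin
  f 0 * g (suc k) + ((f ∘ suc) ⋆ g) k  ≡⟨ cong (_+_ (f 0 * g (suc k))) (⋆-comm (f ∘ suc) g k) ⟩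
  f 0 * g (suc k) + (g ⋆ (f ∘ suc)) k  ≡⟨ +-comm (f 0 * g (suc k)) _ ⟩
  (g ⋆ (f ∘ suc)) k + f 0 * g (suc k)  ≡⟨ cong (_+_ ((g ⋆ (f ∘ suc)) k)) (*-comm (f 0) (g (suc k))) ⟩
  (g ⋆ (f ∘ suc)) k + g (suc k) * f 0  ≡⟨ sym (⋆-sucʳ g f k) ⟩
  (g ⋆ f) (suc k)                      ∎

⋆-distribʳ-+ : ∀ (f f′ g : Series) → (λ j → f j + f′ j) ⋆ g ≗ λ k → (f ⋆ g) k + (f′ ⋆ g) k
⋆-distribʳ-+ f f′ g k = trans (∑<-cong (suc k) (λ j → *-distribʳ-+ (g (k ∸ j)) (f j) (f′ j)))
                              (∑<-+ (suc k) (λ j → f j * g (k ∸ j)) (λ j → f′ j * g (k ∸ j)))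

⋆-*ˡ : ∀ c (f g : Series) → (λ j → c * f j) ⋆ g ≗ λ k → c * (f ⋆ g) k
⋆-*ˡ c f g k = trans (∑<-cong (suc k) (λ j → *-assoc c (f j) (g (k ∸ j))))
                     (∑<-*ˡ (suc k) c (λ j → f j * g (k ∸ j)))

⋆-assoc : ∀ (f g h : Series) → (f ⋆ g) ⋆ h ≗ f ⋆ (g ⋆ h)
⋆-assoc f g h zero    = solve 3 (λ a b c → ((a :* b :+ con 0) :* c) :+ con 0 := a :* (b :* c :+ con 0) :+ con 0) refl (f 0) (g 0) (h 0)
⋆-assoc f g h (suc k) = begin
  (f 0 * g 0 + 0) * h (suc k) + (((f ⋆ g) ∘ suc) ⋆ h) k
    ≡⟨ cong (_+_ ((f 0 * g 0 + 0) * h (suc k))) (⋆-distribʳ-+ (λ j → f 0 * g (suc j)) ((f ∘ suc) ⋆ g) h k) ⟩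
  (f 0 * g 0 + 0) * h (suc k) + (((λ j → f 0 * g (suc j)) ⋆ h) k + ((f ∘ suc) ⋆ g ⋆ h) k)
    ≡⟨ cong₂ (λ x y → (f 0 * g 0 + 0) * h (suc k) + (x + y)) (⋆-*ˡ (f 0) (g ∘ suc) h k) (⋆-assoc (f ∘ suc) g h k) ⟩
  (f 0 * g 0 + 0) * h (suc k) + (f 0 * ((g ∘ suc) ⋆ h) k + ((f ∘ suc) ⋆ (g ⋆ h)) k)
    ≡⟨ solve 5 (λ a b c x y → (a :* b :+ con 0) :* c :+ (a :* x :+ y) := a :* (b :* c :+ x) :+ y) refl
         (f 0) (g 0) (h (suc k)) (((g ∘ suc) ⋆ h) k) (((f ∘ suc) ⋆ (g ⋆ h)) k) ⟩
  (f ⋆ (g ⋆ h)) (suc k) ∎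

⋆-identityˡ : ∀ (g : Series) → 𝟙 ⋆ g ≗ g
⋆-identityˡ g zero    = +-identityʳ (g 0 + 0) ⟨ trans ⟩ +-identityʳ (g 0)
⋆-identityˡ g (suc k) = cong₂ _+_ (+-identityʳ (g (suc k))) (∑<-zero (suc k) (λ _ → refl)) ⟨ trans ⟩ +-identityʳ _

⋆-interchange : ∀ (f g h e : Series) → (f ⋆ g) ⋆ (h ⋆ e) ≗ (f ⋆ h) ⋆ (g ⋆ e)
⋆-interchange f g h e k = begin
  ((f ⋆ g) ⋆ (h ⋆ e)) k  ≡⟨ ⋆-assoc f g (h ⋆ e) k ⟩
  (f ⋆ (g ⋆ (h ⋆ e))) k  ≡⟨ ⋆-cong {f} {f} (λ _ → refl) inner k ⟩
  (f ⋆ (h ⋆ (g ⋆ e))) k  ≡⟨ sym (⋆-assoc f h (g ⋆ e) k) ⟩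
  ((f ⋆ h) ⋆ (g ⋆ e)) k  ∎
  where
  inner : g ⋆ (h ⋆ e) ≗ h ⋆ (g ⋆ e)
  inner j = sym (⋆-assoc g h e j) ⟨ trans ⟩ (⋆-cong {g = e} {e} (⋆-comm g h) (λ _ → refl) j ⟨ trans ⟩ ⋆-assoc h g e j)

-- Shifts and dilations

shift : ℕ → Series → Series
shift zero    f k       = f k
shift (suc a) f zero    = 0
shift (suc a) f (suc k) = shift a f k

shift-+ : ∀ a (f : Series) t → shift a f (a + t) ≡ f t
shift-+ zero    f t = refl
shift-+ (suc a) f t = shift-+ a f t

shift-< : ∀ a (f : Series) {k} → k < a → shift a f k ≡ 0
shift-< (suc a) f {zero}  _         = refl
shift-< (suc a) f {suc k} (s≤s k<a) = shift-< a f k<a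

module Dilation (e : ℕ) where

  d : ℕ
  d = suc e

  -- dilate c f is t^c · f(t^d); the offset c counts down to the next coefficient of f,
  -- which keeps the recursion structural.
  dilate : ℕ → Series → Series
  dilate (suc c) f zero    = 0
  dilate (suc c) f (suc k) = dilate c f k
  dilate zero    f zero    = f 0
  dilate zero    f (suc k) = dilate e (f ∘ suc) k

  dilate-cong : ∀ c {f g : Series} → f ≗ g → dilate c f ≗ dilate c g
  dilate-cong (suc c) f≗g zero    = refl
  dilate-cong (suc c) f≗g (suc k) = dilate-cong c f≗g k
  dilate-cong zero    f≗g zero    = f≗g 0
  dilate-cong zero    f≗g (suc k) = dilate-cong e (f≗g ∘ suc) k

  dilate-+ : ∀ c (f g : Series) → dilate c (λ j → f j + g j) ≗ λ k → dilate c f k + dilate c g k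
  dilate-+ (suc c) f g zero    = refl
  dilate-+ (suc c) f g (suc k) = dilate-+ c f g k
  dilate-+ zero    f g zero    = refl
  dilate-+ zero    f g (suc k) = dilate-+ e (f ∘ suc) (g ∘ suc) k

  dilate-*ˡ : ∀ c a (f : Series) → dilate c (λ j → a * f j) ≗ λ k → a * dilate c f k
  dilate-*ˡ (suc c) a f zero    = sym (*-zeroʳ a)
  dilate-*ˡ (suc c) a f (suc k) = dilate-*ˡ c a f k
  dilate-*ˡ zero    a f zero    = refl
  dilate-*ˡ zero    a f (suc k) = dilate-*ˡ e a (f ∘ suc) k

  dilate-𝟙 : dilate 0 𝟙 ≗ 𝟙
  dilate-𝟙 zero    = refl
  dilate-𝟙 (suc k) = vanish e k
    where
    vanish : ∀ c k → dilate c (const 0) k ≡ 0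
    vanish (suc c) zero    = refl
    vanish (suc c) (suc k) = vanish c k
    vanish zero    zero    = refl
    vanish zero    (suc k) = vanish e k

  dilate≗shift : ∀ c (f : Series) → dilate c f ≗ shift c (dilate 0 f)
  dilate≗shift zero    f k       = refl
  dilate≗shift (suc c) f zero    = refl
  dilate≗shift (suc c) f (suc k) = dilate≗shift c f k

  dilate-hit : ∀ c (f : Series) q → dilate c f (c + q * d) ≡ f q
  dilate-hit (suc c) f q       = dilate-hit c f q
  dilate-hit zero    f zero    = refl
  dilate-hit zero    f (suc q) = dilate-hit e (f ∘ suc) q

  dilate-% : ∀ c (f : Series) j → j % d ≡ c → dilate c f j ≡ f (j / d)
  dilate-% c f j j%d≡c = begin
    dilate c f j                    ≡⟨ cong (dilate c f) (m≡m%n+[m/n]*n j d) ⟩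
    dilate c f (j % d + (j / d) * d) ≡⟨ cong (λ ρ → dilate c f (ρ + (j / d) * d)) j%d≡c ⟩
    dilate c f (c + (j / d) * d)     ≡⟨ dilate-hit c f (j / d) ⟩
    f (j / d)                        ∎

  dilate-off : ∀ c (f : Series) q ρ → ρ < d → c < d → ρ ≢ c → dilate c f (ρ + q * d) ≡ 0
  dilate-off zero    f q       zero    _   _   ρ≢c = contradiction refl ρ≢c
  dilate-off zero    f q       (suc ρ) ρ<d _   _   =
    dilate-off e (f ∘ suc) q ρ (m<n⇒m<1+n (≤-pred ρ<d)) ≤-refl (<⇒≢ (≤-pred ρ<d))
  dilate-off (suc c) f q       (suc ρ) ρ<d c<d ρ≢c =
    dilate-off c f q ρ (m<n⇒m<1+n (≤-pred ρ<d)) (m<n⇒m<1+n (≤-pred c<d)) (ρ≢c ∘ cong suc)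
  dilate-off (suc c) f zero    zero    _   _   _   = refl
  dilate-off (suc c) f (suc q) zero    _   c<d _   =
    dilate-off c f q e ≤-refl (m<n⇒m<1+n (≤-pred c<d)) (≢-sym (<⇒≢ (≤-pred c<d)))

  dilate-miss : ∀ c (f : Series) j → c < d → j % d ≢ c → dilate c f j ≡ 0
  dilate-miss c f j c<d j%d≢c = begin
    dilate c f j                          ≡⟨ cong (dilate c f) (m≡m%n+[m/n]*n j d) ⟩
    dilate c f (j % d + (j / d) * d)      ≡⟨ dilate-off c f (j / d) (j % d) (m%n<n j d) c<d j%d≢c ⟩
    0                                     ∎

  ⋆-dilate : ∀ c c′ (f g : Series) → dilate c f ⋆ dilate c′ g ≗ dilate (c + c′) (f ⋆ g)
  ⋆-dilate-suc : ∀ c c′ (f g : Series) → dilate (suc c) f ⋆ dilate c′ g ≗ dilate (suc c + c′) (f ⋆ g)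
  ⋆-dilate-suc c c′ f g zero    = refl
  ⋆-dilate-suc c c′ f g (suc k) = ⋆-dilate c c′ f g k
  ⋆-dilate (suc c) c′ f g k = ⋆-dilate-suc c c′ f g k
  ⋆-dilate zero (suc c′) f g k = begin
    (dilate 0 f ⋆ dilate (suc c′) g) k      ≡⟨ ⋆-comm (dilate 0 f) (dilate (suc c′) g) k ⟩
    (dilate (suc c′) g ⋆ dilate 0 f) k      ≡⟨ ⋆-dilate-suc c′ 0 g f k ⟩
    dilate (suc c′ + 0) (g ⋆ f) k           ≡⟨ cong (λ c → dilate c (g ⋆ f) k) (+-identityʳ (suc c′)) ⟩
    dilate (suc c′) (g ⋆ f) k               ≡⟨ dilate-cong (suc c′) (⋆-comm g f) k ⟩
    dilate (suc c′) (f ⋆ g) k               ∎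
  ⋆-dilate zero zero f g zero    = refl
  ⋆-dilate zero zero f g (suc k) = begin
    f 0 * dilate e (g ∘ suc) k + (dilate e (f ∘ suc) ⋆ dilate 0 g) k
      ≡⟨ cong (_+_ (f 0 * dilate e (g ∘ suc) k)) (⋆-dilate e 0 (f ∘ suc) g k) ⟩
    f 0 * dilate e (g ∘ suc) k + dilate (e + 0) ((f ∘ suc) ⋆ g) k
      ≡⟨ cong₂ _+_ (sym (dilate-*ˡ e (f 0) (g ∘ suc) k))
                   (cong (λ c → dilate c ((f ∘ suc) ⋆ g) k) (+-identityʳ e)) ⟩
    dilate e (λ j → f 0 * g (suc j)) k + dilate e ((f ∘ suc) ⋆ g) k
      ≡⟨ sym (dilate-+ e (λ j → f 0 * g (suc j)) ((f ∘ suc) ⋆ g) k) ⟩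
    dilate 0 (f ⋆ g) (suc k) ∎

  dilate⋆-∑< : ∀ c (F G : Series) k N → k < N →
               (dilate c F ⋆ G) k ≡ ∑< N (λ m → F m * shift (c + m * d) G k)
  dilate⋆-∑< (suc c) F G zero    N       _   = sym (∑<-zero N (λ m → *-zeroʳ (F m)))
  dilate⋆-∑< (suc c) F G (suc k) N       k<N = dilate⋆-∑< c F G k N (<⇒≤ k<N)
  dilate⋆-∑< zero    F G zero    (suc N) _   =
    cong (_+_ (F 0 * G 0)) (sym (∑<-zero N (λ m → *-zeroʳ (F (suc m)))))
  dilate⋆-∑< zero    F G (suc k) (suc N) k<N =
    cong (_+_ (F 0 * G (suc k))) (dilate⋆-∑< e (F ∘ suc) G k N (≤-pred k<N))

  sieve : ∀ c (F : Series) → c < d → (∀ m → m % d ≢ c → F m ≡ 0) → F ≗ dilate c (λ i → F (c + i * d))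
  sieve c F c<d off j with j % d ≟ c
  ... | no  j%d≢c = trans (off j j%d≢c) (sym (dilate-miss c _ j c<d j%d≢c))
  ... | yes j%d≡c = begin
    F j                                         ≡⟨ cong F j≡ ⟩
    F (c + (j / d) * d)                         ≡⟨ sym (dilate-hit c (λ i → F (c + i * d)) (j / d)) ⟩
    dilate c (λ i → F (c + i * d)) (c + (j / d) * d) ≡⟨ cong (dilate c (λ i → F (c + i * d))) (sym j≡) ⟩
    dilate c (λ i → F (c + i * d)) j            ∎
    where
    j≡ : j ≡ c + (j / d) * d
    j≡ = trans (m≡m%n+[m/n]*n j d) (cong (_+ (j / d) * d) j%d≡c)

  shift-dilate-hit : ∀ a (f : Series) q → shift a (dilate 0 f) (a + q * d) ≡ f q
  shift-dilate-hit a f q = trans (shift-+ a (dilate 0 f) (q * d)) (dilate-hit 0 f q)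

  shift-dilate-miss : ∀ a (f : Series) k → a % d ≢ k % d → shift a (dilate 0 f) k ≡ 0
  shift-dilate-miss a f k a≢k with k <? a
  ... | yes k<a = shift-< a (dilate 0 f) k<a
  ... | no  k≮a with m≤n⇒∃[o]m+o≡n (≮⇒≥ k≮a)
  ...   | t , a+t≡k = begin
    shift a (dilate 0 f) k        ≡⟨ cong (shift a (dilate 0 f)) (sym a+t≡k) ⟩
    shift a (dilate 0 f) (a + t)  ≡⟨ shift-+ a (dilate 0 f) t ⟩
    dilate 0 f t                  ≡⟨ dilate-miss 0 f t (s≤s z≤n) (a≢k ∘ sym ∘ [a+t]%d≡a%d) ⟩
    0                             ∎
    where
    [a+t]%d≡a%d : t % d ≡ 0 → k % d ≡ a % d
    [a+t]%d≡a%d t%d≡0 = begin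
      k % d                     ≡⟨ cong (_% d) (sym a+t≡k) ⟩
      (a + t) % d               ≡⟨ %-distribˡ-+ a t d ⟩
      (a % d + t % d) % d       ≡⟨ cong (λ u → (a % d + u) % d) t%d≡0 ⟩
      (a % d + 0) % d           ≡⟨ cong (_% d) (+-identityʳ (a % d)) ⟩
      a % d % d                 ≡⟨ m%n%n≡m%n a d ⟩
      a % d                     ∎

  dilate-linear⋆ : ∀ c (G : Series) → dilate 0 (linear c) ⋆ G ≗ λ j → G j + c * shift d G j
  dilate-linear⋆ c G j = begin
    (dilate 0 (linear c) ⋆ G) j
      ≡⟨ dilate⋆-∑< 0 (linear c) G j (2 + j) (m<n⇒m<1+n ≤-refl) ⟩
    (G j + 0) + (c * shift (d + 0) G j + ∑< j (λ _ → 0))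
      ≡⟨ cong₂ _+_ (+-identityʳ (G j))
               (cong₂ _+_ (cong (λ a → c * shift a G j) (+-identityʳ d)) (∑<-zero j (λ _ → refl))) ⟩
    G j + (c * shift d G j + 0)
      ≡⟨ cong (_+_ (G j)) (+-identityʳ _) ⟩
    G j + c * shift d G j ∎

  ∑<-dilate : ∀ N c (g : Series) I → (∀ i → I ≤ i → g i ≡ 0) → (∀ i → N ≤ c + i * d → g i ≡ 0) →
              ∑< N (dilate c g) ≡ ∑< I g
  ∑<-dilate zero    c       g I       _      beyondN = sym (∑<-zero I (λ i → beyondN i z≤n))
  ∑<-dilate (suc N) (suc c) g I       beyondI beyondN = ∑<-dilate N c g I beyondI (λ i → beyondN i ∘ s≤s)
  ∑<-dilate (suc N) zero    g zero    beyondI beyondN =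
    cong₂ _+_ (beyondI 0 z≤n) (∑<-dilate N e (g ∘ suc) 0 (λ i _ → beyondI (suc i) z≤n) (λ i _ → beyondI (suc i) z≤n))
  ∑<-dilate (suc N) zero    g (suc I) beyondI beyondN =
    cong (_+_ (g 0)) (∑<-dilate N e (g ∘ suc) I (λ i → beyondI (suc i) ∘ s≤s) (λ i → beyondN (suc i) ∘ s≤s))

-- Symmetric functions as coefficients of products of series

sumL-applyUpTo : ∀ (F : Series) (g : ℕ → ℕ) N → sumL (List.map F (applyUpTo g N)) ≡ ∑< N (F ∘ g)
sumL-applyUpTo F g zero    = refl
sumL-applyUpTo F g (suc N) = cong (_+_ (F (g 0))) (sumL-applyUpTo F (g ∘ suc) N)

sumL-concatMap : ∀ {A B : Set} (F : B → ℕ) (g : A → List B) (xs : List A) →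
                 sumL (List.map F (concatMap g xs)) ≡ sumL (List.map (λ x → sumL (List.map F (g x))) xs)
sumL-concatMap F g []       = refl
sumL-concatMap F g (x ∷ xs) = begin
  sumL (List.map F (g x List.++ concatMap g xs))              ≡⟨ cong sumL (map-++ F (g x) (concatMap g xs)) ⟩
  sumL (List.map F (g x) List.++ List.map F (concatMap g xs)) ≡⟨ sum-++ (List.map F (g x)) _ ⟩
  sumL (List.map F (g x)) + sumL (List.map F (concatMap g xs))
    ≡⟨ cong (_+_ (sumL (List.map F (g x)))) (sumL-concatMap F g xs) ⟩
  sumL (List.map (λ x → sumL (List.map F (g x))) (x ∷ xs))    ∎

sumL-filterᵇ : ∀ {A : Set} (F : A → ℕ) (p : A → Bool) (xs : List A) →
               sumL (List.map F (filterᵇ p xs)) ≡ sumL (List.map (λ x → if p x then F x else 0) xs)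
sumL-filterᵇ F p []       = refl
sumL-filterᵇ F p (x ∷ xs) with p x
... | true  = cong (_+_ (F x)) (sumL-filterᵇ F p xs)
... | false = sumL-filterᵇ F p xs

productAt : ∀ {n} → Vec Series n → Vec ℕ n → ℕ
productAt []       []       = 1
productAt (f ∷ fs) (j ∷ js) = f j * productAt fs js

⨂ : ∀ {n} → Vec Series n → Series
⨂ {n} fs k = sumL (List.map (productAt fs) (weakComps n k))

⨂-[] : ⨂ [] ≗ 𝟙
⨂-[] zero    = refl
⨂-[] (suc k) = refl

⨂-∷ : ∀ {n} (f : Series) (fs : Vec Series n) → ⨂ (f ∷ fs) ≗ f ⋆ ⨂ fs
⨂-∷ {n} f fs k = begin
  sumL (List.map (productAt (f ∷ fs)) (concatMap (λ j → List.map (j ∷_) (weakComps n (k ∸ j))) (upTo (suc k))))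
    ≡⟨ sumL-concatMap (productAt (f ∷ fs)) (λ j → List.map (j ∷_) (weakComps n (k ∸ j))) (upTo (suc k)) ⟩
  sumL (List.map (λ j → sumL (List.map (productAt (f ∷ fs)) (List.map (j ∷_) (weakComps n (k ∸ j))))) (upTo (suc k)))
    ≡⟨ sumL-applyUpTo _ (λ j → j) (suc k) ⟩
  ∑< (suc k) (λ j → sumL (List.map (productAt (f ∷ fs)) (List.map (j ∷_) (weakComps n (k ∸ j)))))
    ≡⟨ ∑<-cong (suc k) (λ j → sumL-map-∷ j (weakComps n (k ∸ j))) ⟩
  (f ⋆ ⨂ fs) k ∎
  where
  sumL-map-∷ : ∀ j (ws : List (Vec ℕ n)) →
               sumL (List.map (productAt (f ∷ fs)) (List.map (j ∷_) ws)) ≡ f j * sumL (List.map (productAt fs) ws)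
  sumL-map-∷ j []       = sym (*-zeroʳ (f j))
  sumL-map-∷ j (w ∷ ws) =
    trans (cong (_+_ (f j * productAt fs w)) (sumL-map-∷ j ws)) (sym (*-distribˡ-+ (f j) _ _))

geometric : ℕ → Series
geometric y j = y ^ j

hNat≡⨂ : ∀ {n} m (ys : Vec ℕ n) → hNat m ys ≡ ⨂ (Vec.map geometric ys) m
hNat≡⨂ {n} m ys = cong sumL (map-cong (monomial≡productAt ys) (weakComps n m))
  where
  monomial≡productAt : ∀ {n} (ys : Vec ℕ n) → monomial ys ≗ productAt (Vec.map geometric ys)
  monomial≡productAt []       []       = refl
  monomial≡productAt (y ∷ ys) (j ∷ js) = cong (_*_ (y ^ j)) (monomial≡productAt ys js)

isAdmissible : (s ℓ j : ℕ) → Bool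
isAdmissible s ℓ j = does (j % suc s ≟ 0) ∨ does (j % suc s ≟ ℓ % suc s)

admissible : (s ℓ x : ℕ) → Series
admissible s ℓ x j = if isAdmissible s ℓ j then x ^ j else 0

modSym≡⨂ : ∀ s ℓ k {n} (xs : Vec ℕ n) → modSym s ℓ k xs ≡ ⨂ (Vec.map (admissible s ℓ) xs) k
modSym≡⨂ s ℓ k {n} xs = trans (sumL-filterᵇ (monomial xs) (allAdmissible s ℓ) (weakComps n k))
                               (cong sumL (map-cong (restricted≡productAt xs) (weakComps n k)))
  where
  if-∧-* : ∀ a b (x y : ℕ) → (if a ∧ b then x * y else 0) ≡ (if a then x else 0) * (if b then y else 0)
  if-∧-* true  true  x y = refl
  if-∧-* true  false x y = sym (*-zeroʳ x)
  if-∧-* false b     x y = refl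
  restricted≡productAt : ∀ {n} (xs : Vec ℕ n) →
    (λ js → if allAdmissible s ℓ js then monomial xs js else 0) ≗ productAt (Vec.map (admissible s ℓ) xs)
  restricted≡productAt []       []       = refl
  restricted≡productAt (x ∷ xs) (j ∷ js) =
    trans (if-∧-* (isAdmissible s ℓ j) (allAdmissible s ℓ js) (x ^ j) (monomial xs js))
          (cong (_*_ (admissible s ℓ x j)) (restricted≡productAt xs js))

-- The generating function of M_k^(s,ℓ)

^-divMod : ∀ x j d .{{_ : NonZero d}} → x ^ j ≡ x ^ (j % d) * (x ^ d) ^ (j / d)
^-divMod x j d = begin
  x ^ j                              ≡⟨ cong (x ^_) (m≡m%n+[m/n]*n j d) ⟩
  x ^ (j % d + (j / d) * d)          ≡⟨ ^-distribˡ-+-* x (j % d) _ ⟩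
  x ^ (j % d) * x ^ ((j / d) * d)    ≡⟨ cong (λ e → x ^ (j % d) * x ^ e) (*-comm (j / d) d) ⟩
  x ^ (j % d) * x ^ (d * (j / d))    ≡⟨ cong (x ^ (j % d) *_) (sym (^-*-assoc x d (j / d))) ⟩
  x ^ (j % d) * (x ^ d) ^ (j / d)    ∎

module _ {s ℓ′ : ℕ} (ℓ<d : suc ℓ′ < suc s) where
  private
    module Dℓ = Dilation ℓ′
    module Dd = Dilation s
    ℓ d : ℕ
    ℓ = suc ℓ′
    d = suc s

  admissible-by-residue : ∀ x j →
    admissible s ℓ x j ≡ Dd.dilate 0 (geometric (x ^ d)) j + x ^ ℓ * Dd.dilate ℓ (geometric (x ^ d)) j
  admissible-by-residue x j with j % d ≟ 0 | j % d ≟ ℓ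
  ... | yes j%d≡0 | _ = begin
    admissible s ℓ x j
      ≡⟨ cong (λ b → if b ∨ does (j % d ≟ ℓ % d) then x ^ j else 0) (dec-true (j % d ≟ 0) j%d≡0) ⟩
    x ^ j                           ≡⟨ ^-divMod x j d ⟩
    x ^ (j % d) * (x ^ d) ^ (j / d) ≡⟨ cong (λ ρ → x ^ ρ * (x ^ d) ^ (j / d)) j%d≡0 ⟩
    (x ^ d) ^ (j / d) + 0           ≡⟨ cong (_+_ ((x ^ d) ^ (j / d))) (sym (*-zeroʳ (x ^ ℓ))) ⟩
    (x ^ d) ^ (j / d) + x ^ ℓ * 0   ≡⟨ cong₂ (λ u v → u + x ^ ℓ * v) (sym (Dd.dilate-% 0 (geometric (x ^ d)) j j%d≡0))
                                                                 (sym (Dd.dilate-miss ℓ (geometric (x ^ d)) j ℓ<d 0≢ℓ)) ⟩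
    Dd.dilate 0 (geometric (x ^ d)) j + x ^ ℓ * Dd.dilate ℓ (geometric (x ^ d)) j ∎
    where
    0≢ℓ : j % d ≢ ℓ
    0≢ℓ j%d≡ℓ = 0≢1+n (trans (sym j%d≡0) j%d≡ℓ)
  ... | no j%d≢0 | yes j%d≡ℓ = begin
    admissible s ℓ x j              ≡⟨ cong (λ b → if b then x ^ j else 0) admissible-ℓ ⟩
    x ^ j                           ≡⟨ ^-divMod x j d ⟩
    x ^ (j % d) * (x ^ d) ^ (j / d)
      ≡⟨ cong₂ (λ u v → u + x ^ v * (x ^ d) ^ (j / d))
               (sym (Dd.dilate-miss 0 (geometric (x ^ d)) j (s≤s z≤n) j%d≢0)) j%d≡ℓ ⟩
    Dd.dilate 0 (geometric (x ^ d)) j + x ^ ℓ * (x ^ d) ^ (j / d)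
      ≡⟨ cong (λ v → Dd.dilate 0 (geometric (x ^ d)) j + x ^ ℓ * v) (sym (Dd.dilate-% ℓ (geometric (x ^ d)) j j%d≡ℓ)) ⟩
    Dd.dilate 0 (geometric (x ^ d)) j + x ^ ℓ * Dd.dilate ℓ (geometric (x ^ d)) j ∎
    where
    admissible-ℓ : isAdmissible s ℓ j ≡ true
    admissible-ℓ = cong₂ _∨_ (dec-false (j % d ≟ 0) j%d≢0)
                             (dec-true (j % d ≟ ℓ % d) (trans j%d≡ℓ (sym (m<n⇒m%n≡m ℓ<d))))
  ... | no j%d≢0 | no j%d≢ℓ = begin
    admissible s ℓ x j              ≡⟨ cong (λ b → if b then x ^ j else 0) inadmissible ⟩
    0                               ≡⟨ sym (*-zeroʳ (x ^ ℓ)) ⟩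
    x ^ ℓ * 0                       ≡⟨ cong₂ (λ u v → u + x ^ ℓ * v) (sym (Dd.dilate-miss 0 (geometric (x ^ d)) j (s≤s z≤n) j%d≢0))
                                                                 (sym (Dd.dilate-miss ℓ (geometric (x ^ d)) j ℓ<d j%d≢ℓ)) ⟩
    Dd.dilate 0 (geometric (x ^ d)) j + x ^ ℓ * Dd.dilate ℓ (geometric (x ^ d)) j ∎
    where
    inadmissible : isAdmissible s ℓ j ≡ false
    inadmissible = cong₂ _∨_ (dec-false (j % d ≟ 0) j%d≢0)
                             (dec-false (j % d ≟ ℓ % d) (j%d≢ℓ ∘ λ eq → trans eq (m<n⇒m%n≡m ℓ<d)))

  admissible≗ : ∀ x → admissible s ℓ x ≗ Dℓ.dilate 0 (linear (x ^ ℓ)) ⋆ Dd.dilate 0 (geometric (x ^ d))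
  admissible≗ x j = sym (begin
    (Dℓ.dilate 0 (linear (x ^ ℓ)) ⋆ G) j ≡⟨ Dℓ.dilate-linear⋆ (x ^ ℓ) G j ⟩
    G j + x ^ ℓ * shift ℓ G j            ≡⟨ cong (λ t → G j + x ^ ℓ * t) (sym (Dd.dilate≗shift ℓ (geometric (x ^ d)) j)) ⟩
    G j + x ^ ℓ * Dd.dilate ℓ (geometric (x ^ d)) j ≡⟨ sym (admissible-by-residue x j) ⟩
    admissible s ℓ x j                   ∎)
    where
    G : Series
    G = Dd.dilate 0 (geometric (x ^ d))

  ⨂-admissible : ∀ {n} (xs : Vec ℕ n) →
    ⨂ (Vec.map (admissible s ℓ) xs) ≗
      Dℓ.dilate 0 (⨂ (Vec.map linear (Vec.map (_^ ℓ) xs))) ⋆ Dd.dilate 0 (⨂ (Vec.map geometric (Vec.map (_^ d) xs)))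
  ⨂-admissible [] k = begin
    ⨂ [] k                                     ≡⟨ ⨂-[] k ⟩
    𝟙 k                                        ≡⟨ sym (⋆-identityˡ 𝟙 k) ⟩
    (𝟙 ⋆ 𝟙) k                                  ≡⟨ sym (⋆-cong unit-ℓ unit-d k) ⟩
    (Dℓ.dilate 0 (⨂ []) ⋆ Dd.dilate 0 (⨂ [])) k ∎
    where
    unit-ℓ : Dℓ.dilate 0 (⨂ []) ≗ 𝟙
    unit-ℓ j = trans (Dℓ.dilate-cong 0 ⨂-[] j) (Dℓ.dilate-𝟙 j)
    unit-d : Dd.dilate 0 (⨂ []) ≗ 𝟙
    unit-d j = trans (Dd.dilate-cong 0 ⨂-[] j) (Dd.dilate-𝟙 j)
  ⨂-admissible (x ∷ xs) k = begin
    ⨂ (admissible s ℓ x ∷ Vec.map (admissible s ℓ) xs) k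
      ≡⟨ ⨂-∷ (admissible s ℓ x) (Vec.map (admissible s ℓ) xs) k ⟩
    (admissible s ℓ x ⋆ ⨂ (Vec.map (admissible s ℓ) xs)) k
      ≡⟨ ⋆-cong (admissible≗ x) (⨂-admissible xs) k ⟩
    ((P ⋆ G) ⋆ (Dℓ.dilate 0 E ⋆ Dd.dilate 0 H)) k
      ≡⟨ ⋆-interchange P G (Dℓ.dilate 0 E) (Dd.dilate 0 H) k ⟩
    ((P ⋆ Dℓ.dilate 0 E) ⋆ (G ⋆ Dd.dilate 0 H)) k
      ≡⟨ ⋆-cong (Dℓ.⋆-dilate 0 0 (linear (x ^ ℓ)) E) (Dd.⋆-dilate 0 0 (geometric (x ^ d)) H) k ⟩
    (Dℓ.dilate 0 (linear (x ^ ℓ) ⋆ E) ⋆ Dd.dilate 0 (geometric (x ^ d) ⋆ H)) k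
      ≡⟨ sym (⋆-cong (Dℓ.dilate-cong 0 (⨂-∷ (linear (x ^ ℓ)) (Vec.map linear (Vec.map (_^ ℓ) xs))))
                     (Dd.dilate-cong 0 (⨂-∷ (geometric (x ^ d)) (Vec.map geometric (Vec.map (_^ d) xs)))) k) ⟩
    (Dℓ.dilate 0 (⨂ (Vec.map linear (Vec.map (_^ ℓ) (x ∷ xs))))
       ⋆ Dd.dilate 0 (⨂ (Vec.map geometric (Vec.map (_^ d) (x ∷ xs))))) k ∎
    where
    P G E H : Series
    P = Dℓ.dilate 0 (linear (x ^ ℓ))
    G = Dd.dilate 0 (geometric (x ^ d))
    E = ⨂ (Vec.map linear (Vec.map (_^ ℓ) xs))
    H = ⨂ (Vec.map geometric (Vec.map (_^ d) xs))

-- Vieta's formula and the Stirling numbers of level ℓ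

linearFactors : ∀ {n} → Vec ℕ n → Poly
linearFactors []       = 1 ∷ []
linearFactors (a ∷ as) = (a ∷ 1 ∷ []) ⊗ linearFactors as

coeff-⊕ : ∀ p q j → coeff (p ⊕ q) j ≡ coeff p j + coeff q j
coeff-⊕ []      q       j       = refl
coeff-⊕ (a ∷ p) []      j       = sym (+-identityʳ _)
coeff-⊕ (a ∷ p) (b ∷ q) zero    = refl
coeff-⊕ (a ∷ p) (b ∷ q) (suc j) = coeff-⊕ p q j

coeff-scale : ∀ a p j → coeff (scale a p) j ≡ a * coeff p j
coeff-scale a []      j       = sym (*-zeroʳ a)
coeff-scale a (b ∷ p) zero    = refl
coeff-scale a (b ∷ p) (suc j) = coeff-scale a p j

coeff-linear⊗-zero : ∀ a p → coeff ((a ∷ 1 ∷ []) ⊗ p) 0 ≡ a * coeff p 0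
coeff-linear⊗-zero a p = trans (coeff-⊕ (scale a p) _ 0) (trans (cong (_+ 0) (coeff-scale a p 0)) (+-identityʳ _))

coeff-linear⊗-suc : ∀ a p j → coeff ((a ∷ 1 ∷ []) ⊗ p) (suc j) ≡ a * coeff p (suc j) + coeff p j
coeff-linear⊗-suc a p j = trans (coeff-⊕ (scale a p) _ (suc j)) (cong₂ _+_ (coeff-scale a p (suc j)) shifted)
  where
  shifted : coeff (scale 1 p ⊕ (0 ∷ [])) j ≡ coeff p j
  shifted = begin
    coeff (scale 1 p ⊕ (0 ∷ [])) j         ≡⟨ coeff-⊕ (scale 1 p) (0 ∷ []) j ⟩
    coeff (scale 1 p) j + coeff (0 ∷ []) j ≡⟨ cong₂ _+_ (coeff-scale 1 p j) (coeff-0 j) ⟩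
    1 * coeff p j + 0                      ≡⟨ trans (+-identityʳ _) (*-identityˡ _) ⟩
    coeff p j                              ∎
    where
    coeff-0 : ∀ j → coeff (0 ∷ []) j ≡ 0
    coeff-0 zero    = refl
    coeff-0 (suc j) = refl

linear⋆-zero : ∀ c (E : Series) → (linear c ⋆ E) 0 ≡ E 0
linear⋆-zero c E = trans (+-identityʳ _) (*-identityˡ _)

linear⋆-suc : ∀ c (E : Series) m → (linear c ⋆ E) (suc m) ≡ E (suc m) + c * E m
linear⋆-suc c E m =
  cong₂ _+_ (*-identityˡ _) (trans (cong (_+_ (c * E m)) (∑<-zero m (λ _ → refl))) (+-identityʳ _))

⨂-linear-vanish : ∀ {n} (as : Vec ℕ n) m → n < m → ⨂ (Vec.map linear as) m ≡ 0
⨂-linear-vanish []       (suc m) _         = refl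
⨂-linear-vanish (a ∷ as) (suc m) (s≤s n<m) = begin
  ⨂ (Vec.map linear (a ∷ as)) (suc m)   ≡⟨ ⨂-∷ (linear a) (Vec.map linear as) (suc m) ⟩
  (linear a ⋆ E) (suc m)                ≡⟨ linear⋆-suc a E m ⟩
  E (suc m) + a * E m                   ≡⟨ cong₂ (λ u v → u + a * v) (⨂-linear-vanish as (suc m) (m<n⇒m<1+n n<m))
                                                                    (⨂-linear-vanish as m n<m) ⟩
  a * 0                                 ≡⟨ *-zeroʳ a ⟩
  0                                     ∎
  where
  E : Series
  E = ⨂ (Vec.map linear as)

coeff-linearFactors-vanish : ∀ {n} (as : Vec ℕ n) j → n < j → coeff (linearFactors as) j ≡ 0
coeff-linearFactors-vanish []       (suc j) _         = refl
coeff-linearFactors-vanish (a ∷ as) (suc j) (s≤s n<j) = begin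
  coeff ((a ∷ 1 ∷ []) ⊗ p) (suc j)     ≡⟨ coeff-linear⊗-suc a p j ⟩
  a * coeff p (suc j) + coeff p j      ≡⟨ cong₂ (λ u v → a * u + v) (coeff-linearFactors-vanish as (suc j) (m<n⇒m<1+n n<j))
                                                                   (coeff-linearFactors-vanish as j n<j) ⟩
  a * 0 + 0                            ≡⟨ trans (+-identityʳ _) (*-zeroʳ a) ⟩
  0                                    ∎
  where
  p : Poly
  p = linearFactors as

vieta : ∀ {n} (as : Vec ℕ n) m j → m + j ≡ n → ⨂ (Vec.map linear as) m ≡ coeff (linearFactors as) j
vieta []                zero    zero    _ = refl
vieta {suc n} (a ∷ as) m j m+j≡1+n = trans (⨂-∷ (linear a) (Vec.map linear as) m) (step m j m+j≡1+n)
  where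
  E : Series
  E = ⨂ (Vec.map linear as)
  p : Poly
  p = linearFactors as
  step : ∀ m j → m + j ≡ suc n → (linear a ⋆ E) m ≡ coeff ((a ∷ 1 ∷ []) ⊗ p) j
  step zero    (suc j) j≡n = begin
    (linear a ⋆ E) 0                    ≡⟨ linear⋆-zero a E ⟩
    E 0                                 ≡⟨ vieta as 0 j (suc-injective j≡n) ⟩
    coeff p j                           ≡⟨ cong (_+ coeff p j) (sym (trans (cong (a *_) top) (*-zeroʳ a))) ⟩
    a * coeff p (suc j) + coeff p j     ≡⟨ sym (coeff-linear⊗-suc a p j) ⟩
    coeff ((a ∷ 1 ∷ []) ⊗ p) (suc j)    ∎
    where
    top : coeff p (suc j) ≡ 0
    top = coeff-linearFactors-vanish as (suc j) (s≤s (≤-reflexive (sym (suc-injective j≡n))))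
  step (suc m) zero    m+0≡n = begin
    (linear a ⋆ E) (suc m)              ≡⟨ linear⋆-suc a E m ⟩
    E (suc m) + a * E m                 ≡⟨ cong₂ (λ u v → u + a * v) (⨂-linear-vanish as (suc m) (s≤s (≤-reflexive (sym m≡n))))
                                                                     (vieta as m 0 (trans (+-identityʳ m) m≡n)) ⟩
    a * coeff p 0                       ≡⟨ sym (coeff-linear⊗-zero a p) ⟩
    coeff ((a ∷ 1 ∷ []) ⊗ p) 0          ∎
    where
    m≡n : m ≡ n
    m≡n = suc-injective (trans (sym (+-identityʳ (suc m))) m+0≡n)
  step (suc m) (suc j) m+j≡n = begin
    (linear a ⋆ E) (suc m)              ≡⟨ linear⋆-suc a E m ⟩
    E (suc m) + a * E m                 ≡⟨ cong₂ (λ u v → u + a * v) (vieta as (suc m) j (trans (sym (+-suc m j)) (suc-injective m+j≡n)))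
                                                                     (vieta as m (suc j) (suc-injective m+j≡n)) ⟩
    coeff p j + a * coeff p (suc j)     ≡⟨ +-comm (coeff p j) _ ⟩
    a * coeff p (suc j) + coeff p j     ≡⟨ sym (coeff-linear⊗-suc a p j) ⟩
    coeff ((a ∷ 1 ∷ []) ⊗ p) (suc j)    ∎

risingPoly-suc : ∀ ℓ n → risingPoly ℓ (suc n) ≡ (0 ^ ℓ ∷ 1 ∷ []) ⊗ linearFactors (powVec n ℓ)
risingPoly-suc ℓ n = cong ((0 ^ ℓ ∷ 1 ∷ []) ⊗_) (factors suc n)
  where
  factors : ∀ (f : ℕ → ℕ) n → List.foldr (λ m acc → (m ^ ℓ ∷ 1 ∷ []) ⊗ acc) (1 ∷ []) (applyUpTo f n)
                              ≡ linearFactors (tabulate {n = n} (λ i → f (toℕ i) ^ ℓ))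
  factors f zero    = refl
  factors f (suc n) = cong ((f 0 ^ ℓ ∷ 1 ∷ []) ⊗_) (factors (f ∘ suc) n)

+m-+n≡+[m∸n] : ∀ {m n} → n ≤ m → + m - + n ≡ + (m ∸ n)
+m-+n≡+[m∸n] {m} {n} n≤m = trans (ℤP.m-n≡m⊖n m n) (ℤP.⊖-≥ n≤m)

+m-+n≡-[1+n∸1+m] : ∀ {m n} → m < n → + m - + n ≡ -[1+ n ∸ suc m ]
+m-+n≡-[1+n∸1+m] {m} {suc n} (s≤s m≤n) =
  trans (ℤP.m-n≡m⊖n m (suc n)) (trans (ℤP.⊖-< (s≤s m≤n)) (cong (λ t → - + t) (+-∸-assoc 1 m≤n)))

+m-+n-+o≡+m-+[n+o] : ∀ m n o → + m - + n - + o ≡ + m - + (n + o)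
+m-+n-+o≡+m-+[n+o] m n o = begin
  + m - + n - + o            ≡⟨ ℤP.+-assoc (+ m) (- + n) (- + o) ⟩
  + m ℤ.+ (- + n ℤ.+ - + o)  ≡⟨ cong (ℤ._+_ (+ m)) (sym (ℤP.neg-distrib-+ (+ n) (+ o))) ⟩
  + m - (+ n ℤ.+ + o)        ≡⟨ cong (λ u → + m - u) (sym (ℤP.pos-+ n o)) ⟩
  + m - + (n + o)            ∎

stirling≡⨂-linear : ∀ ℓ′ n m → stirlingℓ (suc ℓ′) (suc n) (+ suc n - + m) ≡ ⨂ (Vec.map linear (powVec n (suc ℓ′))) m
stirling≡⨂-linear ℓ′ n m with m ≤? suc n
... | no m≰1+n = trans (cong (coeffℤ (risingPoly (suc ℓ′) (suc n))) (+m-+n≡-[1+n∸1+m] (≰⇒> m≰1+n)))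
                      (sym (⨂-linear-vanish (powVec n (suc ℓ′)) m (<-trans (n<1+n n) (≰⇒> m≰1+n))))
... | yes m≤1+n with m ≤? n
...   | yes m≤n = begin
  coeffℤ (risingPoly (suc ℓ′) (suc n)) (+ suc n - + m)
    ≡⟨ cong (coeffℤ (risingPoly (suc ℓ′) (suc n))) (trans (+m-+n≡+[m∸n] m≤1+n) (cong +_ (+-∸-assoc 1 m≤n))) ⟩
  coeff (risingPoly (suc ℓ′) (suc n)) (suc (n ∸ m))
    ≡⟨ cong (λ p → coeff p (suc (n ∸ m))) (risingPoly-suc (suc ℓ′) n) ⟩
  coeff ((0 ∷ 1 ∷ []) ⊗ linearFactors (powVec n (suc ℓ′))) (suc (n ∸ m))
    ≡⟨ coeff-linear⊗-suc 0 (linearFactors (powVec n (suc ℓ′))) (n ∸ m) ⟩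
  coeff (linearFactors (powVec n (suc ℓ′))) (n ∸ m)
    ≡⟨ sym (vieta (powVec n (suc ℓ′)) m (n ∸ m) (m+[n∸m]≡n m≤n)) ⟩
  ⨂ (Vec.map linear (powVec n (suc ℓ′))) m ∎
...   | no m≰n = begin
  coeffℤ (risingPoly (suc ℓ′) (suc n)) (+ suc n - + m)
    ≡⟨ cong (coeffℤ (risingPoly (suc ℓ′) (suc n))) (trans (+m-+n≡+[m∸n] m≤1+n) (cong +_ (m≤n⇒m∸n≡0 (≰⇒> m≰n)))) ⟩
  coeff (risingPoly (suc ℓ′) (suc n)) 0
    ≡⟨ cong (λ p → coeff p 0) (risingPoly-suc (suc ℓ′) n) ⟩
  coeff ((0 ∷ 1 ∷ []) ⊗ linearFactors (powVec n (suc ℓ′))) 0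
    ≡⟨ coeff-linear⊗-zero 0 (linearFactors (powVec n (suc ℓ′))) ⟩
  0
    ≡⟨ sym (⨂-linear-vanish (powVec n (suc ℓ′)) m (≰⇒> m≰n)) ⟩
  ⨂ (Vec.map linear (powVec n (suc ℓ′))) m ∎

/<⇒<* : ∀ {m i} d .{{_ : NonZero d}} → m / d < i → m < i * d
/<⇒<* {m} {i} d m/d<i = ≰⇒> (λ i*d≤m → <⇒≱ m/d<i (subst (_≤ m / d) (m*n/n≡m i d) (/-monoˡ-≤ d i*d≤m)))

sumTo≡∑< : ∀ U (f : Series) → Σ[ I ∈ ℕ ] (sumTo U f ≡ ∑< I f × (∀ i → I ≤ i → U ℤ.< + i))
sumTo≡∑< (+ u)    f = suc u , sumL-applyUpTo f (λ i → i) (suc u) , λ _ u<i → ℤ.+<+ u<i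
sumTo≡∑< -[1+ w ] f = 0 , refl , λ _ _ → ℤ.-<+

module _ {d : ℕ} .{{_ : NonZero d}} where

  %-congˡ-* : ∀ {x y} b → x % d ≡ y % d → (x * b) % d ≡ (y * b) % d
  %-congˡ-* {x} {y} b x≡y = begin
    (x * b) % d                 ≡⟨ %-distribˡ-* x b d ⟩
    ((x % d) * (b % d)) % d     ≡⟨ cong (λ u → (u * (b % d)) % d) x≡y ⟩
    ((y % d) * (b % d)) % d     ≡⟨ sym (%-distribˡ-* y b d) ⟩
    (y * b) % d                 ∎

  module _ {a a⁻¹ : ℕ} (inverse : (a * a⁻¹) % d ≡ 1) where

    *-inverse-% : ∀ m → (m * a * a⁻¹) % d ≡ m % d
    *-inverse-% m = begin
      (m * a * a⁻¹) % d                 ≡⟨ cong (_% d) (*-assoc m a a⁻¹) ⟩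
      (m * (a * a⁻¹)) % d               ≡⟨ %-distribˡ-* m (a * a⁻¹) d ⟩
      ((m % d) * ((a * a⁻¹) % d)) % d   ≡⟨ cong (λ u → ((m % d) * u) % d) inverse ⟩
      ((m % d) * 1) % d                 ≡⟨ cong (_% d) (*-identityʳ (m % d)) ⟩
      m % d % d                         ≡⟨ m%n%n≡m%n m d ⟩
      m % d                             ∎

    *-cancelʳ-% : ∀ m m′ → (m * a) % d ≡ (m′ * a) % d → m % d ≡ m′ % d
    *-cancelʳ-% m m′ eq = trans (sym (*-inverse-% m)) (trans (%-congˡ-* a⁻¹ eq) (*-inverse-% m′))

    inverse-*-% : ∀ k → (((k * a⁻¹) % d) * a) % d ≡ k % d
    inverse-*-% k = begin
      (((k * a⁻¹) % d) * a) % d  ≡⟨ %-congˡ-* a (m%n%n≡m%n (k * a⁻¹) d) ⟩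
      (k * a⁻¹ * a) % d          ≡⟨ cong (_% d) (*-assoc k a⁻¹ a) ⟩
      (k * (a⁻¹ * a)) % d        ≡⟨ cong (λ u → (k * u) % d) (*-comm a⁻¹ a) ⟩
      (k * (a * a⁻¹)) % d        ≡⟨ cong (_% d) (sym (*-assoc k a a⁻¹)) ⟩
      (k * a * a⁻¹) % d          ≡⟨ *-inverse-% k ⟩
      k % d                      ∎

map-powVec : ∀ n e → Vec.map (_^ e) (powVec n 1) ≡ powVec n e
map-powVec n e = trans (sym (tabulate-∘ (_^ e) (λ i → suc (toℕ i) ^ 1)))
                       (tabulate-cong (λ i → cong (_^ e) (^-identityʳ (suc (toℕ i)))))

-- Evaluation at (1, …, n)

module Evaluation (n k s ℓ′ : ℕ) (ℓ<d : suc ℓ′ < suc s) {ℓinv : ℕ} (inverse : (suc ℓ′ * ℓinv) % suc s ≡ 1)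
                  (r : ℕ) (r≡ : r ≡ (k * ℓinv) % suc s) where

  module Dℓ = Dilation ℓ′
  module Dd = Dilation s

  ℓ d K R : ℕ
  ℓ = suc ℓ′
  d = suc s
  K = k / d
  R = (r * ℓ) / d

  E H : Series
  E = ⨂ (Vec.map linear (powVec n ℓ))
  H a = hNat a (powVec n d)

  modSym≡⋆ : modSym s ℓ k (powVec n 1) ≡ (Dℓ.dilate 0 E ⋆ Dd.dilate 0 H) k
  modSym≡⋆ = begin
    modSym s ℓ k (powVec n 1)
      ≡⟨ modSym≡⨂ s ℓ k (powVec n 1) ⟩
    ⨂ (Vec.map (admissible s ℓ) (powVec n 1)) k
      ≡⟨ ⨂-admissible ℓ<d (powVec n 1) k ⟩
    (Dℓ.dilate 0 (⨂ (Vec.map linear (Vec.map (_^ ℓ) (powVec n 1))))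
      ⋆ Dd.dilate 0 (⨂ (Vec.map geometric (Vec.map (_^ d) (powVec n 1))))) k
      ≡⟨ ⋆-cong (Dℓ.dilate-cong 0 elementary) (Dd.dilate-cong 0 complete) k ⟩
    (Dℓ.dilate 0 E ⋆ Dd.dilate 0 H) k ∎
    where
    elementary : ⨂ (Vec.map linear (Vec.map (_^ ℓ) (powVec n 1))) ≗ E
    elementary m = cong (λ v → ⨂ (Vec.map linear v) m) (map-powVec n ℓ)
    complete : ⨂ (Vec.map geometric (Vec.map (_^ d) (powVec n 1))) ≗ H
    complete a = trans (cong (λ v → ⨂ (Vec.map geometric v) a) (map-powVec n d)) (sym (hNat≡⨂ a (powVec n d)))

  -- term m is the contribution e_m(1^ℓ, …, n^ℓ) · [t^k] t^(m ℓ) H(t^d) to M_k.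
  term classTerm : Series
  term m = E m * shift (m * ℓ) (Dd.dilate 0 H) k
  classTerm i = term (r + i * d)

  r<d : r < d
  r<d = subst (_< d) (sym r≡) (m%n<n (k * ℓinv) d)

  rℓ≡k : (r * ℓ) % d ≡ k % d
  rℓ≡k = trans (cong (λ u → (u * ℓ) % d) r≡) (inverse-*-% {a⁻¹ = ℓinv} inverse k)

  term-off : ∀ m → m % d ≢ r → term m ≡ 0
  term-off m m%d≢r = trans (cong (E m *_) (Dd.shift-dilate-miss (m * ℓ) H k mℓ≢k)) (*-zeroʳ (E m))
    where
    mℓ≢k : (m * ℓ) % d ≢ k % d
    mℓ≢k mℓ≡k = m%d≢r (trans (*-cancelʳ-% {a⁻¹ = ℓinv} inverse m r (trans mℓ≡k (sym rℓ≡k))) (m<n⇒m%n≡m r<d))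

  ⋆≡∑<-sieved : (Dℓ.dilate 0 E ⋆ Dd.dilate 0 H) k ≡ ∑< (suc k) (Dd.dilate r classTerm)
  ⋆≡∑<-sieved = trans (Dℓ.dilate⋆-∑< 0 E (Dd.dilate 0 H) k (suc k) ≤-refl)
                      (∑<-cong (suc k) (Dd.sieve r term r<d term-off))

  position : ∀ i → (r + i * d) * ℓ ≡ k % d + (R + i * ℓ) * d
  position i = begin
    (r + i * d) * ℓ                 ≡⟨ solve 4 (λ r i d ℓ → (r :+ i :* d) :* ℓ := r :* ℓ :+ (i :* ℓ) :* d) refl r i d ℓ ⟩
    r * ℓ + (i * ℓ) * d             ≡⟨ cong (_+ (i * ℓ) * d) (trans (m≡m%n+[m/n]*n (r * ℓ) d) (cong (_+ R * d) rℓ≡k)) ⟩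
    (k % d + R * d) + (i * ℓ) * d   ≡⟨ solve 4 (λ a b c d → (a :+ b :* d) :+ c :* d := a :+ (b :+ c) :* d) refl (k % d) R (i * ℓ) d ⟩
    k % d + (R + i * ℓ) * d         ∎

  classTerm-late : ∀ i → K < R + i * ℓ → classTerm i ≡ 0
  classTerm-late i K<R+iℓ =
    trans (cong (E (r + i * d) *_) (shift-< _ (Dd.dilate 0 H) k<)) (*-zeroʳ (E (r + i * d)))
    where
    k< : k < (r + i * d) * ℓ
    k< = subst₂ _<_ (sym (m≡m%n+[m/n]*n k d)) (sym (position i)) (+-monoʳ-< (k % d) (*-monoˡ-< d K<R+iℓ))

  classTerm-value : ∀ i → R + i * ℓ ≤ K → classTerm i ≡ E (r + i * d) * H (K ∸ (R + i * ℓ))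
  classTerm-value i R+iℓ≤K = cong (E (r + i * d) *_) (begin
    shift a (Dd.dilate 0 H) k                 ≡⟨ cong (shift a (Dd.dilate 0 H)) k≡ ⟩
    shift a (Dd.dilate 0 H) (a + q * d)       ≡⟨ Dd.shift-dilate-hit a H q ⟩
    H q                                       ∎)
    where
    a q : ℕ
    a = (r + i * d) * ℓ
    q = K ∸ (R + i * ℓ)
    k≡ : k ≡ a + q * d
    k≡ = begin
      k                               ≡⟨ m≡m%n+[m/n]*n k d ⟩
      k % d + K * d                   ≡⟨ cong (λ u → k % d + u * d) (sym (m+[n∸m]≡n R+iℓ≤K)) ⟩
      k % d + (R + i * ℓ + q) * d     ≡⟨ solve 4 (λ a b c d → a :+ (b :+ c) :* d := (a :+ b :* d) :+ c :* d) refl (k % d) (R + i * ℓ) q d ⟩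
      (k % d + (R + i * ℓ) * d) + q * d ≡⟨ cong (_+ q * d) (sym (position i)) ⟩
      a + q * d                       ∎

  classTerm-beyond-k : ∀ i → suc k ≤ r + i * d → classTerm i ≡ 0
  classTerm-beyond-k i k<r+id =
    trans (cong (E (r + i * d) *_) (shift-< _ (Dd.dilate 0 H) (≤-trans k<r+id (m≤m*n (r + i * d) ℓ))))
          (*-zeroʳ (E (r + i * d)))

  classTerm-beyond-n : ∀ i → n < r + i * d → classTerm i ≡ 0
  classTerm-beyond-n i n<r+id =
    cong (_* shift ((r + i * d) * ℓ) (Dd.dilate 0 H) k) (⨂-linear-vanish (powVec n ℓ) (r + i * d) n<r+id)

  U : ℤ
  U = ((+ n - + r) /ℕ d) ⊓ (+ K - + R)

  summand : Series
  summand i = hInt (+ (k / suc s) - + ((r * ℓ) / suc s) - + (i * ℓ)) (powVec n (suc s))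
              * stirlingℓ ℓ (n + 1) (+ (n + 1) - + r - + (i * suc s))

  summand≡classTerm : ∀ i → summand i ≡ classTerm i
  summand≡classTerm i with R + i * ℓ ≤? K
  ... | yes R+iℓ≤K = begin
    summand i                                 ≡⟨ cong₂ _*_ h-part stirling-part ⟩
    H (K ∸ (R + i * ℓ)) * E (r + i * d)       ≡⟨ *-comm (H (K ∸ (R + i * ℓ))) _ ⟩
    E (r + i * d) * H (K ∸ (R + i * ℓ))       ≡⟨ sym (classTerm-value i R+iℓ≤K) ⟩
    classTerm i                               ∎
    where
    h-part : hInt (+ K - + R - + (i * ℓ)) (powVec n d) ≡ H (K ∸ (R + i * ℓ))
    h-part = cong (λ z → hInt z (powVec n d)) (trans (+m-+n-+o≡+m-+[n+o] K R (i * ℓ)) (+m-+n≡+[m∸n] R+iℓ≤K))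
    stirling-part : stirlingℓ ℓ (n + 1) (+ (n + 1) - + r - + (i * d)) ≡ E (r + i * d)
    stirling-part = begin
      stirlingℓ ℓ (n + 1) (+ (n + 1) - + r - + (i * d)) ≡⟨ cong (λ N → stirlingℓ ℓ N (+ N - + r - + (i * d))) (+-comm n 1) ⟩
      stirlingℓ ℓ (suc n) (+ suc n - + r - + (i * d))   ≡⟨ cong (stirlingℓ ℓ (suc n)) (+m-+n-+o≡+m-+[n+o] (suc n) r (i * d)) ⟩
      stirlingℓ ℓ (suc n) (+ suc n - + (r + i * d))     ≡⟨ stirling≡⨂-linear ℓ′ n (r + i * d) ⟩
      E (r + i * d)                                     ∎
  ... | no R+iℓ≰K = begin
    summand i  ≡⟨ cong (λ z → hInt z (powVec n d) * stirlingℓ ℓ (n + 1) (+ (n + 1) - + r - + (i * d)))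
                      (trans (+m-+n-+o≡+m-+[n+o] K R (i * ℓ)) (+m-+n≡-[1+n∸1+m] (≰⇒> R+iℓ≰K))) ⟩
    0          ≡⟨ sym (classTerm-late i (≰⇒> R+iℓ≰K)) ⟩
    classTerm i ∎

  classTerm-beyond-U : ∀ i → U ℤ.< + i → classTerm i ≡ 0
  classTerm-beyond-U i U<i with + i ℤP.≤? (+ n - + r) /ℕ d | + i ℤP.≤? + K - + R
  ... | yes i≤A | yes i≤B = contradiction (ℤP.⊓-glb i≤A i≤B) (ℤP.<⇒≱ U<i)
  ... | no  i≰A | _       = classTerm-beyond-n i (n< (ℤP.≰⇒> i≰A))
    where
    n< : (+ n - + r) /ℕ d ℤ.< + i → n < r + i * d
    n< A<i with r ≤? n
    ... | no  r≰n = ≤-trans (≰⇒> r≰n) (m≤m+n r (i * d))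
    ... | yes r≤n = subst (_< r + i * d) (m+[n∸m]≡n r≤n)
                      (+-monoʳ-< r (/<⇒<* d (ℤP.drop‿+<+ (subst (ℤ._< + i) (cong (_/ℕ d) (+m-+n≡+[m∸n] r≤n)) A<i))))
  ... | yes _   | no  i≰B = classTerm-late i (K< (ℤP.≰⇒> i≰B))
    where
    K< : + K - + R ℤ.< + i → K < R + i * ℓ
    K< B<i with R ≤? K
    ... | no  R≰K = ≤-trans (≰⇒> R≰K) (m≤m+n R (i * ℓ))
    ... | yes R≤K = ≤-trans (subst (_< R + i) (m+[n∸m]≡n R≤K)
                                   (+-monoʳ-< R (ℤP.drop‿+<+ (subst (ℤ._< + i) (+m-+n≡+[m∸n] R≤K) B<i))))
                            (+-monoʳ-≤ R (m≤m*n i ℓ))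

  ∑<-sieved≡sumTo : ∑< (suc k) (Dd.dilate r classTerm) ≡ sumTo U summand
  ∑<-sieved≡sumTo with sumTo≡∑< U summand
  ... | I , sumTo≡∑<I , U<i = begin
    ∑< (suc k) (Dd.dilate r classTerm)
      ≡⟨ Dd.∑<-dilate (suc k) r classTerm I (λ i → classTerm-beyond-U i ∘ U<i i) classTerm-beyond-k ⟩
    ∑< I classTerm                      ≡⟨ ∑<-cong I (λ i → sym (summand≡classTerm i)) ⟩
    ∑< I summand                        ≡⟨ sym sumTo≡∑<I ⟩
    sumTo U summand                     ∎

-- For ℓ = 0 the inverse hypothesis is absurd.
theorem4p4 : (n k s ℓ : ℕ) → 1 ≤ s → ℓ < suc s → gcd ℓ (suc s) ≡ 1 →
    (ℓinv : ℕ) → (ℓ * ℓinv) % suc s ≡ 1 →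
    (r : ℕ) → r ≡ (k * ℓinv) % suc s →
    modSym s ℓ k (powVec n 1)
      ≡ sumTo (((+ n - + r) /ℕ suc s) ⊓ (+ (k / suc s) - + ((r * ℓ) / suc s)))
          (λ i → hInt (+ (k / suc s) - + ((r * ℓ) / suc s) - + (i * ℓ)) (powVec n (suc s))
                 * stirlingℓ ℓ (n + 1) (+ (n + 1) - + r - + (i * suc s)))
theorem4p4 n k s zero     _ _   _ ℓinv ()      r r≡
theorem4p4 n k s (suc ℓ′) _ ℓ<d _ ℓinv inverse r r≡ = begin
  modSym s (suc ℓ′) k (powVec n 1)    ≡⟨ modSym≡⋆ ⟩
  (Dℓ.dilate 0 E ⋆ Dd.dilate 0 H) k   ≡⟨ ⋆≡∑<-sieved ⟩
  ∑< (suc k) (Dd.dilate r classTerm)  ≡⟨ ∑<-sieved≡sumTo ⟩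
  sumTo U summand                     ∎
  where
  open Evaluation n k s ℓ′ ℓ<d inverse r r≡
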